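{- Let $n\ge3$ and $V(K_n)=\{v_1,\dots,v_n\}$. Consider the following families of cliques of $K_n$: the near-pencil $\mathrm{NP}(K_n)=(Q_1,\dots,Q_n)$ with $Q_1=\{v_1,\dots,v_{n-1}\}$ and $Q_{i+1}=\{v_i,v_n\}$ for $i\in[n-1]$; the silly partition $\mathrm{SP}(K_n)=(Q_1,\dots,Q_n)$ with $Q_1=V(K_n)$ and $Q_i=\{v_i\}$ for $2\le i\le n$; and, when $n=r^2+r+1$ and a finite projective plane with point set $V(K_n)$ is given, $\mathrm{PP}(K_n)$, the family of its $n$ lines. For such a family $(Q_1,\dots,Q_m)$ let its EGP-set be the family $(S_{v})_{v\in V(K_n)}$ with $S_v=\{j\in[m]: v\in Q_j\}$. Then the EGP-sets of $\mathrm{NP}(K_n)$, $\mathrm{PP}(K_n)$ and $\mathrm{SP}(K_n)$ all belong to $F_{sd}(K_n)$.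
   Context: A set representation of a graph $H$ is a family $\mathcal S=(S_x)_{x\in V(H)}$ of nonempty sets with $xy\in E(H)$ iff $S_x\cap S_y\neq\emptyset$ for distinct $x,y$; universe $U(\mathcal S)=\bigcup_xS_x$. It is simple if $|S_x\cap S_y|\le1$ and distinct if $S_x\ne S_y$ for distinct $x,y$. $\theta_{sd}(H)$ is the minimum $|U(\mathcal S)|$ over simple distinct representations of $H$, and $F_{sd}(H)$ is the set of simple distinct representations with $|U(\mathcal S)|=\theta_{sd}(H)$. A finite projective plane: a point set with lines such that any two points lie on exactly one line, any two lines meet in exactly one point, and there are four points no three collinear; with $n$ points it has $n$ lines. -}

module Defs where

open import Data.Nat using (ℕ; zero; suc; _+_; _*_; _∸_; _≤_; _<_; _<?_)
open import Data.Nat.Properties using () renaming (_≟_ to _≟ℕ_)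
open import Data.Fin using (Fin; toℕ) renaming (zero to fzero)
open import Data.Fin.Subset using (Subset; _∈_; _∩_; ∣_∣; Nonempty; ⋃; ⊤; ⁅_⁆)
open import Data.Vec using (tabulate; lookup)
open import Data.List using (map; allFin)
open import Data.Product using (_×_; ∃; ∃-syntax)
open import Data.Sum using (_⊎_)
open import Data.Unit using () renaming (⊤ to Unit)
open import Relation.Nullary using (¬_; ⌊_⌋)
open import Relation.Nullary.Decidable using (_⊎-dec_)
open import Relation.Binary.PropositionalEquality using (_≡_; _≢_)
open import Function.Bundles using (_⇔_)

-- A graph on vertex set Fin n is given by its adjacency relation
-- (only consulted on pairs of distinct vertices).
Graph : ℕ → Set₁
Graph n = Fin n → Fin n → Set

-- The complete graph K_n on Fin n (vertex v_i is the index i-1).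
Complete : (n : ℕ) → Graph n
Complete n x y = Unit

Family : ℕ → ℕ → Set
Family n k = Fin n → Subset k

Universe : ∀ {n k} → Family n k → Subset k
Universe {n} S = ⋃ (map S (allFin n))

IsRep : ∀ {n k} → Graph n → Family n k → Set
IsRep H S =
  (∀ x → Nonempty (S x)) ×
  (∀ x y → x ≢ y → (H x y ⇔ Nonempty (S x ∩ S y)))

IsSimple : ∀ {n k} → Family n k → Set
IsSimple S = ∀ x y → x ≢ y → ∣ S x ∩ S y ∣ ≤ 1

IsDistinct : ∀ {n k} → Family n k → Set
IsDistinct S = ∀ x y → x ≢ y → S x ≢ S y

IsSDRep : ∀ {n k} → Graph n → Family n k → Set
IsSDRep H S = IsRep H S × IsSimple S × IsDistinct S

-- S ∈ F_sd(H): S is a simple distinct representation whose universe has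
-- size θ_sd(H), i.e. no simple distinct representation (over any finite
-- universe, w.l.o.g. Fin k) has a smaller universe.
InFsd : ∀ {n k} → Graph n → Family n k → Set
InFsd {n} {k} H S =
  IsSDRep H S ×
  (∀ (k' : ℕ) (T : Family n k') → IsSDRep H T → ∣ Universe S ∣ ≤ ∣ Universe T ∣)

CliqueFamily : ℕ → ℕ → Set
CliqueFamily m n = Fin m → Subset n

egp : ∀ {m n} → CliqueFamily m n → Family n m
egp Q v = tabulate (λ j → lookup (Q j) v)

-- Near-pencil NP(K_n), 0-based: Q index 0 = {v : index < n-1};
-- Q index t (t ≥ 1) = {vertex index t-1, vertex index n-1}.
nearPencil : (n : ℕ) → CliqueFamily n n
nearPencil n j = tabulate (λ v → member (toℕ j) (toℕ v))
  where
  member : ℕ → ℕ → Data.Fin.Subset.Side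
  member zero    v = ⌊ v <? n ∸ 1 ⌋
  member (suc t) v = ⌊ (v ≟ℕ t) ⊎-dec (v ≟ℕ (n ∸ 1)) ⌋

sillyPartition : (n : ℕ) → CliqueFamily n n
sillyPartition n fzero = ⊤
sillyPartition n (Data.Fin.suc j) = ⁅ Data.Fin.suc j ⁆

record ProjectivePlane (n : ℕ) : Set where
  field
    line : Fin n → Subset n
    twoPoints : ∀ x y → x ≢ y → ∃[ j ] (x ∈ line j × y ∈ line j)
    twoPointsUnique : ∀ x y → x ≢ y → ∀ j j' →
      x ∈ line j → y ∈ line j → x ∈ line j' → y ∈ line j' → j ≡ j'
    twoLines : ∀ i j → i ≢ j → ∃[ p ] (p ∈ line i × p ∈ line j)
    twoLinesUnique : ∀ i j → i ≢ j → ∀ p q →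
      p ∈ line i → p ∈ line j → q ∈ line i → q ∈ line j → p ≡ q
    quad : Fin 4 → Fin n
    quadDistinct : ∀ a b → a ≢ b → quad a ≢ quad b
    quadGeneral : ∀ a b c → a ≢ b → a ≢ c → b ≢ c → ∀ j →
      ¬ (quad a ∈ line j × quad b ∈ line j × quad c ∈ line j)

module Submission where

-- The near-pencil, the projective plane and the silly partition all give
-- simple distinct representations of K_n over n symbols; the theorem says
-- that no such representation can do with fewer than n symbols.
--
-- Dually, a simple distinct representation (S_x) of K_n is a linear space:
-- the vertices x are points, each symbol u is the "line" of vertices whose
-- set contains u, and two distinct points lie on exactly one common line.
-- The lower bound  n ≤ |U(S)|  is therefore the de Bruijn–Erdős theorem,
-- proved here in two cases:
--   * some symbol lies in every set (a pencil): then every other symbol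
--     lies in at most one set and distinctness leaves at most one set
--     without a private symbol;
--   * otherwise Conway's double counting: with r_x = |S_x| and d_u the
--     number of sets containing u, a set missing u has r_x ≥ d_u.  If
--     |U| < n, weighting each non-incident pair (x , u) once by
--     1/(n(|U| - r_x)) and once by 1/(|U|(n - d_u)) sums to 1 both times,
--     yet the second weight is always smaller.  Denominators are cleared
--     with the common multiple (n·|U|)!.

open import Defs
open import Data.Nat using (ℕ; zero; suc; _+_; _*_; _∸_; _≤_; _<_; z≤n; s≤s; _!; ≢-nonZero; _<?_; _≤?_)
open import Data.Nat.Properties
open import Data.Nat.Divisibility using (_∣_; ∣-trans; m∣m*n; m≤n⇒m!∣n!)
open import Algebra.Properties.Semiring.Sum +-*-semiring using (sum; sum-cong-≗; ∑-comm; ∑-distrib-+; *-distribˡ-sum; *-distribʳ-sum)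
open import Data.Bool using (Bool; true; false; not; _∧_)
open import Data.Bool.Properties using (¬-not; ∧-identityʳ) renaming (_≟_ to _≟ᵇ_)
open import Data.Fin using (Fin; zero; suc; toℕ; fromℕ<)
open import Data.Fin.Properties using (any?; all?; toℕ-injective; toℕ<n; toℕ-fromℕ<) renaming (suc-injective to fsuc-injective; _≟_ to _≟ᶠ_)
open import Data.Vec using ([]; _∷_; lookup)
open import Data.Vec.Properties using ([]=⇒lookup; lookup⇒[]=; lookup∘tabulate; tabulate∘lookup; tabulate-cong)
open import Data.Fin.Subset using (Subset; ∣_∣; _∈_; _∩_; ⋃; ⊤; ⁅_⁆; Nonempty)
open import Data.Fin.Subset.Properties using (x∈p∩q⁻; x∈p∩q⁺; x∈p∪q⁻; x∈p∪q⁺; ∉⊥; ∣p∣≤n; ∈⊤; x∈⁅x⁆; x∈⁅y⁆⇒x≡y)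
open import Data.List using (List; []; _∷_; map; allFin)
open import Data.List.Relation.Unary.Any using (Any; here; there; satisfied)
open import Data.List.Relation.Unary.Any.Properties using (map⁺; map⁻)
open import Data.List.Membership.Propositional using (lose)
open import Data.List.Membership.Propositional.Properties using (∈-allFin)
open import Data.Product using (Σ; ∃-syntax; _×_; _,_; proj₁; proj₂)
open import Data.Sum using (_⊎_; inj₁; inj₂)
open import Data.Unit using (tt)
open import Data.Empty using (⊥; ⊥-elim)
open import Function using (_∘_; case_of_)
open import Function.Bundles using (Equivalence; mk⇔; _⇔_)
open import Relation.Nullary using (¬_; Dec; yes; no; ¬?; ⌊_⌋)
open import Relation.Nullary.Decidable using (_×-dec_; _⊎-dec_)
open import Relation.Binary.PropositionalEquality
open import Data.Nat.Solver using (module +-*-Solver)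
open +-*-Solver using (solve; _:*_; _:=_)

ind : Bool → ℕ
ind true  = 1
ind false = 0

count : ∀ {m} → (Fin m → Bool) → ℕ
count P = sum (λ i → ind (P i))

sum-mono : ∀ {m} {f g : Fin m → ℕ} → (∀ i → f i ≤ g i) → sum f ≤ sum g
sum-mono {zero}  f≤g = z≤n
sum-mono {suc m} f≤g = +-mono-≤ (f≤g zero) (sum-mono (f≤g ∘ suc))

sum-mono-< : ∀ {m} {f g : Fin m → ℕ} → (∀ i → f i ≤ g i) → ∀ i → f i < g i → sum f < sum g
sum-mono-< f≤g zero    fi<gi = +-mono-<-≤ fi<gi (sum-mono (f≤g ∘ suc))
sum-mono-< f≤g (suc i) fi<gi = +-mono-≤-< (f≤g zero) (sum-mono-< (f≤g ∘ suc) i fi<gi)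

sum-const : ∀ m c → sum {m} (λ _ → c) ≡ m * c
sum-const zero    c = refl
sum-const (suc m) c = cong (c +_) (sum-const m c)

count-mono : ∀ {m} {P Q : Fin m → Bool} → (∀ i → P i ≡ true → Q i ≡ true) → count P ≤ count Q
count-mono {P = P} {Q} P⇒Q = sum-mono pointwise
  where
  pointwise : ∀ i → ind (P i) ≤ ind (Q i)
  pointwise i with P i | P⇒Q i
  ... | false | _   = z≤n
  ... | true  | imp rewrite imp refl = ≤-refl

count-pos : ∀ {m} (P : Fin m → Bool) (w : Fin m) → P w ≡ true → 1 ≤ count P
count-pos P zero    Pw rewrite Pw = s≤s z≤n
count-pos P (suc w) Pw = ≤-trans (count-pos (P ∘ suc) w Pw) (m≤n+m _ (ind (P zero)))

count-complement : ∀ {m} (P : Fin m → Bool) → count P + count (not ∘ P) ≡ m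
count-complement {zero}  P = refl
count-complement {suc m} P with P zero
... | true  = cong suc (count-complement (P ∘ suc))
... | false = trans (+-suc (count (P ∘ suc)) _) (cong suc (count-complement (P ∘ suc)))

_－_ : ∀ {m} → (Fin m → Bool) → Fin m → Fin m → Bool
(P － w) i = P i ∧ not ⌊ i ≟ᶠ w ⌋

count-remove : ∀ {m} (P : Fin m → Bool) (w : Fin m) → P w ≡ true → count P ≡ suc (count (P － w))
count-remove {suc m} P zero Pw rewrite Pw =
  cong suc (sum-cong-≗ (λ i → cong ind (sym (∧-identityʳ (P (suc i))))))
count-remove {suc m} P (suc w) Pw =
  trans (cong (ind (P zero) +_) (count-remove (P ∘ suc) w Pw))
        (trans (+-suc (ind (P zero)) _)
               (cong suc (cong₂ _+_ (cong ind (sym (∧-identityʳ (P zero))))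
                                    (sum-cong-≗ (cong ind ∘ shift)))))
  where
  shift : ∀ i → ((P ∘ suc) － w) i ≡ (P － suc w) (suc i)
  shift i with i ≟ᶠ w
  ... | yes _ = refl
  ... | no  _ = refl

－-keep : ∀ {m} (P : Fin m → Bool) {v w : Fin m} → P v ≡ true → v ≢ w → (P － w) v ≡ true
－-keep P {v} {w} Pv v≢w with v ≟ᶠ w
... | yes v≡w = ⊥-elim (v≢w v≡w)
... | no  _   rewrite Pv = refl

count-injection : ∀ {m k} (P : Fin m → Bool) (Q : Fin k → Bool) (g : ∀ x → P x ≡ true → Fin k) →
  (∀ x Px → Q (g x Px) ≡ true) →
  (∀ x y Px Py → g x Px ≡ g y Py → x ≡ y) → count P ≤ count Q
count-injection {zero}  P Q g maps inj = z≤n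
count-injection {suc m} P Q g maps inj with P zero in P0
... | false = count-injection (P ∘ suc) Q (g ∘ suc) (maps ∘ suc) inj-suc
  where
  inj-suc : ∀ x y Px Py → g (suc x) Px ≡ g (suc y) Py → x ≡ y
  inj-suc x y Px Py e = fsuc-injective (inj (suc x) (suc y) Px Py e)
... | true = subst (suc (count (P ∘ suc)) ≤_) (sym (count-remove Q (g zero P0) (maps zero P0)))
               (s≤s (count-injection (P ∘ suc) (Q － g zero P0) (g ∘ suc) maps-rest inj-suc))
  where
  inj-suc : ∀ x y Px Py → g (suc x) Px ≡ g (suc y) Py → x ≡ y
  inj-suc x y Px Py e = fsuc-injective (inj (suc x) (suc y) Px Py e)
  maps-rest : ∀ x Px → (Q － g zero P0) (g (suc x) Px) ≡ true
  maps-rest x Px = －-keep Q (maps (suc x) Px) (λ e → case inj (suc x) zero Px P0 e of λ ())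

count≤1 : ∀ {m} (P : Fin m → Bool) → (∀ x y → P x ≡ true → P y ≡ true → x ≡ y) → count P ≤ 1
count≤1 P unique = count-injection P (λ (_ : Fin 1) → true) (λ _ _ → zero) (λ _ _ → refl)
                     (λ x y Px Py _ → unique x y Px Py)

count≤1⇒unique : ∀ {m} (P : Fin m → Bool) → count P ≤ 1 → ∀ v w → P v ≡ true → P w ≡ true → v ≡ w
count≤1⇒unique P #P≤1 v w Pv Pw with v ≟ᶠ w
... | yes v≡w = v≡w
... | no  v≢w = ⊥-elim (<⇒≱ (s≤s (count-pos (P － v) w (－-keep P Pw (v≢w ∘ sym))))
                            (subst (_≤ 1) (count-remove P v Pv) #P≤1))

accepted : ∀ {A : Set} (d : Dec A) → ⌊ d ⌋ ≡ true → A
accepted (yes a) _ = a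

accept : ∀ {A : Set} (d : Dec A) → A → ⌊ d ⌋ ≡ true
accept (yes _) _ = refl
accept (no ¬a) a = ⊥-elim (¬a a)

rejected : ∀ {A : Set} (d : Dec A) → not ⌊ d ⌋ ≡ true → ¬ A
rejected (no ¬a) _ = ¬a

∣p∣≡count : ∀ {k} (p : Subset k) → ∣ p ∣ ≡ count (lookup p)
∣p∣≡count []          = refl
∣p∣≡count (true ∷ p)  = cong suc (∣p∣≡count p)
∣p∣≡count (false ∷ p) = ∣p∣≡count p

-- Membership as a Boolean equation, the form in which membership is counted.
_∈ᵇ_ : ∀ {k} → Fin k → Subset k → Set
u ∈ᵇ p = lookup p u ≡ true

∈⇒∈ᵇ : ∀ {k} {u : Fin k} {p : Subset k} → u ∈ p → u ∈ᵇ p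
∈⇒∈ᵇ = []=⇒lookup

∈ᵇ⇒∈ : ∀ {k} {u : Fin k} {p : Subset k} → u ∈ᵇ p → u ∈ p
∈ᵇ⇒∈ {u = u} {p} = lookup⇒[]= u p

∈ᵇ-∩⁺ : ∀ {k} {u : Fin k} (p q : Subset k) → u ∈ᵇ p → u ∈ᵇ q → u ∈ᵇ (p ∩ q)
∈ᵇ-∩⁺ p q u∈p u∈q = ∈⇒∈ᵇ {p = p ∩ q} (x∈p∩q⁺ (∈ᵇ⇒∈ {p = p} u∈p , ∈ᵇ⇒∈ {p = q} u∈q))

∈ᵇ-∩⁻ : ∀ {k} {u : Fin k} (p q : Subset k) → u ∈ᵇ (p ∩ q) → u ∈ᵇ p × u ∈ᵇ q
∈ᵇ-∩⁻ p q u∈p∩q with x∈p∩q⁻ p q (∈ᵇ⇒∈ {p = p ∩ q} u∈p∩q)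
... | u∈p , u∈q = ∈⇒∈ᵇ u∈p , ∈⇒∈ᵇ u∈q

subset-ext : ∀ {k} (p q : Subset k) → (∀ u → u ∈ᵇ p → u ∈ᵇ q) → (∀ u → u ∈ᵇ q → u ∈ᵇ p) → p ≡ q
subset-ext p q p⊆q q⊆p =
  trans (sym (tabulate∘lookup p)) (trans (tabulate-cong (λ u → same (p⊆q u) (q⊆p u))) (tabulate∘lookup q))
  where
  same : ∀ {a b : Bool} → (a ≡ true → b ≡ true) → (b ≡ true → a ≡ true) → a ≡ b
  same {true}  {true}  _ _ = refl
  same {true}  {false} a⇒b _ = sym (a⇒b refl)
  same {false} {true}  _ b⇒a = b⇒a refl
  same {false} {false} _ _ = refl

record SDComplete {n k} (S : Family n k) : Set where
  field
    nonempty : ∀ x → ∃[ u ] u ∈ᵇ S x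
    meet     : ∀ x y → x ≢ y → ∃[ u ] (u ∈ᵇ S x × u ∈ᵇ S y)
    unique   : ∀ x y → x ≢ y → ∀ u v → u ∈ᵇ S x → u ∈ᵇ S y → v ∈ᵇ S x → v ∈ᵇ S y → u ≡ v
    distinct : IsDistinct S

fromSDRep : ∀ {n k} {S : Family n k} → IsSDRep (Complete n) S → SDComplete S
fromSDRep {S = S} ((nonempty , adjacent) , simple , distinct) = record
  { nonempty = λ x → proj₁ (nonempty x) , ∈⇒∈ᵇ (proj₂ (nonempty x))
  ; meet     = meet
  ; unique   = λ x y x≢y u v u∈x u∈y v∈x v∈y →
      count≤1⇒unique (lookup (S x ∩ S y)) (subst (_≤ 1) (∣p∣≡count (S x ∩ S y)) (simple x y x≢y))
        u v (∈ᵇ-∩⁺ (S x) (S y) u∈x u∈y) (∈ᵇ-∩⁺ (S x) (S y) v∈x v∈y)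
  ; distinct = distinct
  }
  where
  meet : ∀ x y → x ≢ y → ∃[ u ] (u ∈ᵇ S x × u ∈ᵇ S y)
  meet x y x≢y with Equivalence.to (adjacent x y x≢y) tt
  ... | u , u∈x∩y = u , ∈ᵇ-∩⁻ (S x) (S y) (∈⇒∈ᵇ u∈x∩y)

toSDRep : ∀ {n k} {S : Family n k} → SDComplete S → IsSDRep (Complete n) S
toSDRep {S = S} L = (nonempty′ , adjacent) , simple , distinct
  where
  open SDComplete L
  nonempty′ : ∀ x → Nonempty (S x)
  nonempty′ x = proj₁ (nonempty x) , ∈ᵇ⇒∈ (proj₂ (nonempty x))
  adjacent : ∀ x y → x ≢ y → Complete _ x y ⇔ Nonempty (S x ∩ S y)
  adjacent x y x≢y with meet x y x≢y
  ... | u , u∈x , u∈y = mk⇔ (λ _ → u , ∈ᵇ⇒∈ (∈ᵇ-∩⁺ (S x) (S y) u∈x u∈y)) (λ _ → tt)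
  simple : IsSimple S
  simple x y x≢y = subst (_≤ 1) (sym (∣p∣≡count (S x ∩ S y))) (count≤1 _ one)
    where
    one : ∀ u v → u ∈ᵇ (S x ∩ S y) → v ∈ᵇ (S x ∩ S y) → u ≡ v
    one u v u∈ v∈ with ∈ᵇ-∩⁻ (S x) (S y) u∈ | ∈ᵇ-∩⁻ (S x) (S y) v∈
    ... | u∈x , u∈y | v∈x , v∈y = unique x y x≢y u v u∈x u∈y v∈x v∈y

∈-⋃⁺ : ∀ {k} {u : Fin k} (ps : List (Subset k)) → Any (u ∈_) ps → u ∈ ⋃ ps
∈-⋃⁺ (p ∷ ps) (here u∈p)   = x∈p∪q⁺ (inj₁ u∈p)
∈-⋃⁺ (p ∷ ps) (there u∈ps) = x∈p∪q⁺ {p = p} (inj₂ (∈-⋃⁺ ps u∈ps))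

∈-⋃⁻ : ∀ {k} {u : Fin k} (ps : List (Subset k)) → u ∈ ⋃ ps → Any (u ∈_) ps
∈-⋃⁻ []       u∈⋃ = ⊥-elim (∉⊥ u∈⋃)
∈-⋃⁻ (p ∷ ps) u∈⋃ with x∈p∪q⁻ p (⋃ ps) u∈⋃
... | inj₁ u∈p  = here u∈p
... | inj₂ u∈ps = there (∈-⋃⁻ ps u∈ps)

∈ᵇ-Universe⁺ : ∀ {n k} (S : Family n k) x u → u ∈ᵇ S x → u ∈ᵇ Universe S
∈ᵇ-Universe⁺ {n} S x u u∈Sx = ∈⇒∈ᵇ (∈-⋃⁺ (map S (allFin n)) (map⁺ (lose (∈-allFin x) (∈ᵇ⇒∈ {p = S x} u∈Sx))))

∈ᵇ-Universe⁻ : ∀ {n k} (S : Family n k) u → u ∈ᵇ Universe S → ∃[ x ] u ∈ᵇ S x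
∈ᵇ-Universe⁻ {n} S u u∈U with satisfied (map⁻ (∈-⋃⁻ (map S (allFin n)) (∈ᵇ⇒∈ u∈U)))
... | x , u∈Sx = x , ∈⇒∈ᵇ u∈Sx

conway-inequality : ∀ d b n → 1 ≤ d → d ≤ b → b < n → n * (b ∸ d) < b * (n ∸ d)
conway-inequality d b n 1≤d d≤b b<n = subst₂ _<_ (sym n*c) (sym b*e)
  (+-mono-≤-< (≤-reflexive (*-comm e c)) (*-monoʳ-< d {{≢-nonZero d≢0}} c<e))
  where
  c e : ℕ
  c = b ∸ d
  e = n ∸ d
  d≢0 : d ≢ 0
  d≢0 refl = <⇒≱ 1≤d z≤n
  c<e : c < e
  c<e = ∸-monoˡ-< b<n d≤b
  n*c : n * c ≡ e * c + d * c
  n*c = trans (cong (_* c) (sym (m∸n+n≡m (≤-trans d≤b (<⇒≤ b<n))))) (*-distribʳ-+ c e d)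
  b*e : b * e ≡ c * e + d * e
  b*e = trans (cong (_* e) (sym (m∸n+n≡m d≤b))) (*-distribʳ-+ e c d)

larger-cofactor : ∀ p a q b → p * a ≡ q * b → q ≢ 0 → a < b → q < p
larger-cofactor p a q b pa≡qb q≢0 a<b with q <? p
... | yes q<p = q<p
... | no  q≮p = ⊥-elim (<-irrefl refl (begin-strict
      p * a ≤⟨ *-monoˡ-≤ a (≮⇒≥ q≮p) ⟩
      q * a <⟨ *-monoʳ-< q {{≢-nonZero q≢0}} a<b ⟩
      q * b ≡⟨ sym pa≡qb ⟩
      p * a ∎))
  where open ≤-Reasoning

∣-factorial : ∀ a N → 1 ≤ a → a ≤ N → a ∣ N !
∣-factorial (suc a) N _ a<N = ∣-trans (m∣m*n (a !)) (m≤n⇒m!∣n! a<N)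

module DeBruijnErdos {m k : ℕ} (T : Family (3 + m) k) (L : SDComplete T) where
  open SDComplete L

  n : ℕ
  n = 3 + m

  inc : Fin n → Fin k → Bool
  inc x u = lookup (T x) u

  inU : Fin k → Bool
  inU u = lookup (Universe T) u

  B : ℕ
  B = count inU

  -- If one symbol u₀ lies in every set, then every other symbol lies in at
  -- most one set, and at most one set consists of u₀ alone; so n ≤ |U|.
  pencil-bound : (u₀ : Fin k) → (∀ x → u₀ ∈ᵇ T x) → n ≤ B
  pencil-bound u₀ through = begin
    n                                      ≡⟨ count-complement Private ⟨
    count Private + count (not ∘ Private)  ≤⟨ +-mono-≤ private≤ trivial≤1 ⟩
    count (inU － u₀) + 1                   ≡⟨ +-comm _ 1 ⟩
    suc (count (inU － u₀))                 ≡⟨ count-remove inU u₀ (∈ᵇ-Universe⁺ T zero u₀ (through zero)) ⟨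
    B                                      ∎
    where
    open ≤-Reasoning
    HasOther : Fin n → Set
    HasOther x = ∃[ v ] (v ∈ᵇ T x × v ≢ u₀)
    hasOther? : ∀ x → Dec (HasOther x)
    hasOther? x = any? (λ v → (inc x v ≟ᵇ true) ×-dec ¬? (v ≟ᶠ u₀))
    Private : Fin n → Bool
    Private x = ⌊ hasOther? x ⌋

    -- A set with a symbol besides u₀ owns that symbol.
    private≤ : count Private ≤ count (inU － u₀)
    private≤ = count-injection Private (inU － u₀) (λ x p → proj₁ (accepted (hasOther? x) p)) maps inj
      where
      maps : ∀ x p → (inU － u₀) (proj₁ (accepted (hasOther? x) p)) ≡ true
      maps x p with accepted (hasOther? x) p
      ... | v , v∈x , v≢u₀ = －-keep inU (∈ᵇ-Universe⁺ T x v v∈x) v≢u₀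
      inj : ∀ x y p q → proj₁ (accepted (hasOther? x) p) ≡ proj₁ (accepted (hasOther? y) q) → x ≡ y
      inj x y p q v≡v′ with accepted (hasOther? x) p | accepted (hasOther? y) q | x ≟ᶠ y
      ... | _ | _ | yes x≡y = x≡y
      ... | v , v∈x , v≢u₀ | _ , v′∈y , _ | no x≢y =
        ⊥-elim (v≢u₀ (sym (unique x y x≢y u₀ v (through x) (through y) v∈x (subst (_∈ᵇ T y) (sym v≡v′) v′∈y))))

    -- Two sets contained in {u₀} coincide, so by distinctness there is at most one.
    trivial≤1 : count (not ∘ Private) ≤ 1
    trivial≤1 = count≤1 _ λ x y px py → same-set x y (rejected (hasOther? x) px) (rejected (hasOther? y) py)
      where
      only-u₀ : ∀ x → ¬ HasOther x → ∀ v → v ∈ᵇ T x → v ≡ u₀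
      only-u₀ x none v v∈x with v ≟ᶠ u₀
      ... | yes v≡u₀ = v≡u₀
      ... | no  v≢u₀ = ⊥-elim (none (v , v∈x , v≢u₀))
      same-set : ∀ x y → ¬ HasOther x → ¬ HasOther y → x ≡ y
      same-set x y nx ny with x ≟ᶠ y
      ... | yes x≡y = x≡y
      ... | no  x≢y = ⊥-elim (distinct x y x≢y (subset-ext (T x) (T y)
              (λ v v∈x → subst (_∈ᵇ T y) (sym (only-u₀ x nx v v∈x)) (through y))
              (λ v v∈y → subst (_∈ᵇ T x) (sym (only-u₀ y ny v v∈y)) (through x))))

  -- Any vertex has two further, distinct vertices (this is where n ≥ 3 is used).
  two-others : ∀ x → Σ (Fin n) λ y → Σ (Fin n) λ z → y ≢ z × y ≢ x × z ≢ x
  two-others zero          = suc zero , suc (suc zero) , (λ ()) , (λ ()) , (λ ())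
  two-others (suc zero)    = zero , suc (suc zero) , (λ ()) , (λ ()) , (λ ())
  two-others (suc (suc x)) = zero , suc zero , (λ ()) , (λ ()) , (λ ())

  -- No set contains the whole universe: if T x did, any set T y (y ≠ x)
  -- would consist of the single symbol it shares with T x, and two such
  -- sets would coincide.
  misses-some : ∀ x → ∃[ u ] (inU u ≡ true × inc x u ≡ false)
  misses-some x with any? (λ u → (inU u ≟ᵇ true) ×-dec (inc x u ≟ᵇ false))
  ... | yes missed = missed
  ... | no  ¬missed with two-others x
  ...   | y , z , y≢z , y≢x , z≢x =
    ⊥-elim (distinct y z y≢z (subset-ext (T y) (T z) (⊆-other y z y≢z y≢x) (⊆-other z y (y≢z ∘ sym) z≢x)))
    where
    full : ∀ u → inU u ≡ true → u ∈ᵇ T x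
    full u u∈U with inc x u in e
    ... | true  = refl
    ... | false = ⊥-elim (¬missed (u , u∈U , e))
    ⊆-other : ∀ y z → y ≢ z → y ≢ x → ∀ w → w ∈ᵇ T y → w ∈ᵇ T z
    ⊆-other y z y≢z y≢x w w∈y with meet y z y≢z
    ... | v , v∈y , v∈z = subst (_∈ᵇ T z) (sym w≡v) v∈z
      where
      w≡v : w ≡ v
      w≡v = unique x y (y≢x ∘ sym) w v (full w (∈ᵇ-Universe⁺ T y w w∈y)) w∈y
                                       (full v (∈ᵇ-Universe⁺ T y v v∈y)) v∈y

  r : Fin n → ℕ
  r x = count (inc x)

  d : Fin k → ℕ
  d u = count (λ x → inc x u)

  r≤B : ∀ x → r x ≤ B
  r≤B x = count-mono (∈ᵇ-Universe⁺ T x)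

  -- A set avoiding u has at least d u symbols: each set through u meets it
  -- in a symbol, and distinct sets through u meet it in distinct symbols.
  d≤r : ∀ x u → inc x u ≡ false → d u ≤ r x
  d≤r x u x∌u = count-injection (λ y → inc y u) (inc x) link link∈x link-injective
    where
    x≢ : ∀ y → u ∈ᵇ T y → x ≢ y
    x≢ y u∈y refl = case trans (sym x∌u) u∈y of λ ()
    link : ∀ y → u ∈ᵇ T y → Fin k
    link y u∈y = proj₁ (meet x y (x≢ y u∈y))
    link∈x : ∀ y u∈y → link y u∈y ∈ᵇ T x
    link∈x y u∈y = proj₁ (proj₂ (meet x y (x≢ y u∈y)))
    link-injective : ∀ y y′ u∈y u∈y′ → link y u∈y ≡ link y′ u∈y′ → y ≡ y′
    link-injective y y′ u∈y u∈y′ same with y ≟ᶠ y′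
    ... | yes y≡y′ = y≡y′
    ... | no  y≢y′ = case trans (sym x∌u) (subst (_∈ᵇ T x) (sym u≡link) (link∈x y u∈y)) of λ ()
      where
      u≡link : u ≡ link y u∈y
      u≡link = unique y y′ y≢y′ u (link y u∈y) u∈y u∈y′ (proj₂ (proj₂ (meet x y (x≢ y u∈y))))
                 (subst (_∈ᵇ T y′) (sym same) (proj₂ (proj₂ (meet x y′ (x≢ y′ u∈y′)))))

  Miss : Fin n → Fin k → Bool
  Miss x u = inU u ∧ not (inc x u)

  Miss-intro : ∀ x u → inU u ≡ true → inc x u ≡ false → Miss x u ≡ true
  Miss-intro x u u∈U x∌u rewrite u∈U | x∌u = refl

  Miss-elim : ∀ x u → Miss x u ≡ true → inU u ≡ true × inc x u ≡ false
  Miss-elim x u miss with inU u | inc x u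
  ... | true | false = refl , refl
  Miss-elim x u () | true  | true
  Miss-elim x u () | false | _

  #missed-by : ∀ x → count (Miss x) ≡ B ∸ r x
  #missed-by x = begin
    count (Miss x)                   ≡⟨ m+n∸n≡m _ (r x) ⟨
    count (Miss x) + r x ∸ r x       ≡⟨ cong (_∸ r x) (∑-distrib-+ (ind ∘ Miss x) (ind ∘ inc x)) ⟨
    sum (λ u → ind (Miss x u) + ind (inc x u)) ∸ r x ≡⟨ cong (_∸ r x) (sum-cong-≗ split) ⟩
    B ∸ r x                          ∎
    where
    open ≡-Reasoning
    split : ∀ u → ind (Miss x u) + ind (inc x u) ≡ ind (inU u)
    split u with inc x u in e
    ... | true rewrite ∈ᵇ-Universe⁺ T x u e = refl
    ... | false with inU u
    ...   | true  = refl
    ...   | false = refl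

  #missing : ∀ u → count (λ x → not (inc x u)) ≡ n ∸ d u
  #missing u = trans (sym (m+n∸m≡n (d u) _)) (cong (_∸ d u) (count-complement (λ x → inc x u)))

  -- Weight a non-incident pair (x , u) by M / a x and by M / b u; both
  -- weightings total M, but M / b u < M / a x for every such pair.
  module Conway (each-missed : ∀ u → ∃[ x ] inc x u ≡ false) (B<n : B < n) where
    a : Fin n → ℕ
    a x = n * (B ∸ r x)

    b : Fin k → ℕ
    b u = B * (n ∸ d u)

    M : ℕ
    M = (n * B) !

    B≥1 : 1 ≤ B
    B≥1 = count-pos inU (proj₁ (nonempty zero)) (∈ᵇ-Universe⁺ T zero _ (proj₂ (nonempty zero)))

    a∣M : ∀ x → a x ∣ M
    a∣M x with misses-some x
    ... | u , u∈U , x∌u = ∣-factorial (a x) (n * B) (*-mono-≤ {1} {n} (s≤s z≤n) B∸r≥1)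
                            (*-monoʳ-≤ n (m∸n≤m B (r x)))
      where
      B∸r≥1 : 1 ≤ B ∸ r x
      B∸r≥1 = subst (1 ≤_) (#missed-by x) (count-pos (Miss x) u (Miss-intro x u u∈U x∌u))

    b∣M : ∀ u → b u ∣ M
    b∣M u with each-missed u
    ... | x , x∌u = ∣-factorial (b u) (n * B) (*-mono-≤ B≥1 n∸d≥1)
                      (≤-trans (*-monoʳ-≤ B (m∸n≤m n (d u))) (≤-reflexive (*-comm B n)))
      where
      n∸d≥1 : 1 ≤ n ∸ d u
      n∸d≥1 = subst (1 ≤_) (#missing u) (count-pos (λ y → not (inc y u)) x (cong not x∌u))

    W : Fin n → ℕ
    W x = _∣_.quotient (a∣M x)

    V : Fin k → ℕ
    V u = _∣_.quotient (b∣M u)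

    W*a : ∀ x → M ≡ W x * a x
    W*a x = _∣_.equality (a∣M x)

    V*b : ∀ u → M ≡ V u * b u
    V*b u = _∣_.equality (b∣M u)

    -- The pointwise comparison of the two weights, from d u ≤ r x.
    V<W : ∀ x u → Miss x u ≡ true → V u < W x
    V<W x u miss with Miss-elim x u miss
    ... | u∈U , x∌u = larger-cofactor (W x) (a x) (V u) (b u) (trans (sym (W*a x)) (V*b u)) V≢0 a<b
      where
      V≢0 : V u ≢ 0
      V≢0 V≡0 = <⇒≱ (1≤n! (n * B)) (≤-reflexive (trans (V*b u) (cong (_* b u) V≡0)))
      d≥1 : 1 ≤ d u
      d≥1 with ∈ᵇ-Universe⁻ T u u∈U
      ... | y , u∈y = count-pos (λ z → inc z u) y u∈y
      a<b : a x < b u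
      a<b = ≤-<-trans (*-monoʳ-≤ n (∸-monoʳ-≤ B (d≤r x u x∌u)))
              (conway-inequality (d u) B n d≥1 (≤-trans (d≤r x u x∌u) (r≤B x)) B<n)

    F G : Fin n → Fin k → ℕ
    F x u = ind (Miss x u) * W x
    G x u = ind (Miss x u) * V u

    row-F : ∀ x → n * sum (F x) ≡ M
    row-F x = begin
      n * sum (F x)                ≡⟨ cong (n *_) (*-distribʳ-sum (W x) (ind ∘ Miss x)) ⟨
      n * (count (Miss x) * W x)   ≡⟨ cong (λ c → n * (c * W x)) (#missed-by x) ⟩
      n * ((B ∸ r x) * W x)        ≡⟨ *-assoc n (B ∸ r x) (W x) ⟨
      a x * W x                    ≡⟨ *-comm (a x) (W x) ⟩
      W x * a x                    ≡⟨ W*a x ⟨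
      M                            ∎
      where open ≡-Reasoning

    column-G : ∀ u → B * sum (λ x → G x u) ≡ ind (inU u) * M
    column-G u = begin
      B * sum (λ x → G x u)                                  ≡⟨ cong (B *_) (sum-cong-≗ λ x → ind-∧ (inU u) (not (inc x u)) (V u)) ⟩
      B * sum (λ x → ind (inU u) * (ind (not (inc x u)) * V u)) ≡⟨ cong (B *_) (*-distribˡ-sum (ind (inU u)) (λ x → ind (not (inc x u)) * V u)) ⟨
      B * (ind (inU u) * sum (λ x → ind (not (inc x u)) * V u)) ≡⟨ cong (λ s → B * (ind (inU u) * s)) (*-distribʳ-sum (V u) (λ x → ind (not (inc x u)))) ⟨
      B * (ind (inU u) * (count (λ x → not (inc x u)) * V u))   ≡⟨ cong (λ c → B * (ind (inU u) * (c * V u))) (#missing u) ⟩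
      B * (ind (inU u) * ((n ∸ d u) * V u))                    ≡⟨ solve 4 (λ β ι δ υ → β :* (ι :* (δ :* υ)) := ι :* (υ :* (β :* δ))) refl B (ind (inU u)) (n ∸ d u) (V u) ⟩
      ind (inU u) * (V u * b u)                                ≡⟨ cong (ind (inU u) *_) (V*b u) ⟨
      ind (inU u) * M                                          ∎
      where
      open ≡-Reasoning
      ind-∧ : ∀ a c v → ind (a ∧ c) * v ≡ ind a * (ind c * v)
      ind-∧ true  c v = sym (+-identityʳ (ind c * v))
      ind-∧ false c v = refl

    total-F : sum (λ x → sum (F x)) ≡ M
    total-F = *-cancelˡ-≡ _ M n (begin
      n * sum (λ x → sum (F x))   ≡⟨ *-distribˡ-sum n (λ x → sum (F x)) ⟩
      sum (λ x → n * sum (F x))   ≡⟨ sum-cong-≗ row-F ⟩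
      sum {n} (λ _ → M)           ≡⟨ sum-const n M ⟩
      n * M                       ∎)
      where open ≡-Reasoning

    total-G : sum (λ u → sum (λ x → G x u)) ≡ M
    total-G = *-cancelˡ-≡ _ M B {{≢-nonZero (λ B≡0 → <⇒≱ B≥1 (≤-reflexive B≡0))}} (begin
      B * sum (λ u → sum (λ x → G x u))   ≡⟨ *-distribˡ-sum B (λ u → sum (λ x → G x u)) ⟩
      sum (λ u → B * sum (λ x → G x u))   ≡⟨ sum-cong-≗ column-G ⟩
      sum (λ u → ind (inU u) * M)         ≡⟨ *-distribʳ-sum M (ind ∘ inU) ⟨
      B * M                               ∎)
      where open ≡-Reasoning

    impossible : ⊥
    impossible = <-irrefl refl (begin-strict
      M                                  ≡⟨ total-G ⟨
      sum (λ u → sum (λ x → G x u))      ≡⟨ ∑-comm G ⟨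
      sum (λ x → sum (G x))              <⟨ sum-mono-< (λ x → sum-mono (G≤F x)) x₀ (sum-mono-< (G≤F x₀) u₀ G<F) ⟩
      sum (λ x → sum (F x))              ≡⟨ total-F ⟩
      M                                  ∎)
      where
      open ≤-Reasoning
      G≤F : ∀ x u → G x u ≤ F x u
      G≤F x u with Miss x u in miss
      ... | true  = *-monoʳ-≤ 1 (<⇒≤ (V<W x u miss))
      ... | false = z≤n
      u₀ : Fin k
      u₀ = proj₁ (nonempty zero)
      x₀ : Fin n
      x₀ = proj₁ (each-missed u₀)
      miss₀ : Miss x₀ u₀ ≡ true
      miss₀ = Miss-intro x₀ u₀ (∈ᵇ-Universe⁺ T zero u₀ (proj₂ (nonempty zero))) (proj₂ (each-missed u₀))
      G<F : G x₀ u₀ < F x₀ u₀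
      G<F rewrite miss₀ = *-monoʳ-< 1 (V<W x₀ u₀ miss₀)

  lower-bound : n ≤ B
  lower-bound with any? (λ u → all? (λ x → inc x u ≟ᵇ true))
  ... | yes (u₀ , through) = pencil-bound u₀ through
  ... | no  no-pencil with n ≤? B
  ...   | yes n≤B = n≤B
  ...   | no  n≰B = ⊥-elim (Conway.impossible each-missed (≰⇒> n≰B))
    where
    each-missed : ∀ u → ∃[ x ] inc x u ≡ false
    each-missed u with any? (λ x → inc x u ≟ᵇ false)
    ... | yes missed = missed
    ... | no  ¬missed = ⊥-elim (no-pencil (u , λ x → ¬-not (λ x∌u → ¬missed (x , x∌u))))

sd-universe-bound : ∀ n k (T : Family n k) → 3 ≤ n → IsSDRep (Complete n) T → n ≤ ∣ Universe T ∣
sd-universe-bound (suc (suc (suc m))) k T (s≤s (s≤s (s≤s _))) rep =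
  subst (suc (suc (suc m)) ≤_) (sym (∣p∣≡count (Universe T))) (DeBruijnErdos.lower-bound T (fromSDRep rep))

optimal : ∀ n → 3 ≤ n → (S : Family n n) → SDComplete S → InFsd (Complete n) S
optimal n 3≤n S L = toSDRep L , λ k T rep → ≤-trans (∣p∣≤n (Universe S)) (sd-universe-bound n k T 3≤n rep)

egp-lookup : ∀ {m n} (Q : CliqueFamily m n) v j → lookup (egp Q v) j ≡ lookup (Q j) v
egp-lookup Q v j = lookup∘tabulate (λ j → lookup (Q j) v) j

-- Silly partition: Q_0 is everything, Q_j = {j} for j ≥ 1.  Any two sets
-- share exactly the symbol 0, and S_j is the only set containing j.
silly-sd : ∀ n → SDComplete (egp (sillyPartition (suc n)))
silly-sd n = record
  { nonempty = λ x → zero , in-0 x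
  ; meet     = λ x y _ → zero , in-0 x , in-0 y
  ; unique   = λ x y x≢y u v u∈x u∈y v∈x v∈y → trans (only-0 x y x≢y u u∈x u∈y) (sym (only-0 x y x≢y v v∈x v∈y))
  ; distinct = distinct
  }
  where
  S : Family (suc n) (suc n)
  S = egp (sillyPartition (suc n))
  in-0 : ∀ v → zero ∈ᵇ S v
  in-0 v = trans (egp-lookup (sillyPartition (suc n)) v zero) (∈⇒∈ᵇ {u = v} {p = ⊤} ∈⊤)
  in-suc⇒ : ∀ v j → suc j ∈ᵇ S v → v ≡ suc j
  in-suc⇒ v j e = x∈⁅y⁆⇒x≡y (suc j) (∈ᵇ⇒∈ {p = ⁅ suc j ⁆} (trans (sym (egp-lookup (sillyPartition (suc n)) v (suc j))) e))
  in-own : ∀ j → suc j ∈ᵇ S (suc j)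
  in-own j = trans (egp-lookup (sillyPartition (suc n)) (suc j) (suc j)) (∈⇒∈ᵇ (x∈⁅x⁆ (suc j)))
  only-0 : ∀ x y → x ≢ y → ∀ u → u ∈ᵇ S x → u ∈ᵇ S y → u ≡ zero
  only-0 x y x≢y zero    _   _   = refl
  only-0 x y x≢y (suc j) u∈x u∈y = ⊥-elim (x≢y (trans (in-suc⇒ x j u∈x) (sym (in-suc⇒ y j u∈y))))
  private-distinct : ∀ j y → suc j ≢ y → S (suc j) ≢ S y
  private-distinct j y j≢y e = j≢y (sym (in-suc⇒ y j (subst (suc j ∈ᵇ_) e (in-own j))))
  distinct : IsDistinct S
  distinct (suc j) y       x≢y   = private-distinct j y x≢y
  distinct zero    (suc j) x≢y e = private-distinct j zero (x≢y ∘ sym) (sym e)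
  distinct zero    zero    x≢y   = ⊥-elim (x≢y refl)

-- The lines of a projective plane: two points lie on exactly one line, and
-- distinct points are told apart by a line through one of them missing the
-- other, which exists since no line contains all of the four general points.
plane-sd : ∀ {n} (P : ProjectivePlane n) → SDComplete (egp (ProjectivePlane.line P))
plane-sd {n} P = record
  { nonempty = nonempty
  ; meet     = meet
  ; unique   = λ x y x≢y u v u∈x u∈y v∈x v∈y →
      twoPointsUnique x y x≢y u v (on u∈x) (on u∈y) (on v∈x) (on v∈y)
  ; distinct = distinct
  }
  where
  open ProjectivePlane P
  S : Family n n
  S = egp line
  on : ∀ {v j} → j ∈ᵇ S v → v ∈ line j
  on {v} {j} e = ∈ᵇ⇒∈ {p = line j} (trans (sym (egp-lookup line v j)) e)
  through : ∀ {v j} → v ∈ line j → j ∈ᵇ S v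
  through {v} {j} v∈j = trans (egp-lookup line v j) (∈⇒∈ᵇ v∈j)
  meet : ∀ x y → x ≢ y → ∃[ j ] (j ∈ᵇ S x × j ∈ᵇ S y)
  meet x y x≢y with twoPoints x y x≢y
  ... | j , x∈j , y∈j = j , through x∈j , through y∈j
  nonempty : ∀ x → ∃[ j ] j ∈ᵇ S x
  nonempty x with quad zero ≟ᶠ x
  ... | yes q₀≡x = proj₁ (meet x (quad (suc zero)) x≢q₁) , proj₁ (proj₂ (meet x (quad (suc zero)) x≢q₁))
    where
    x≢q₁ : x ≢ quad (suc zero)
    x≢q₁ x≡q₁ = quadDistinct zero (suc zero) (λ ()) (trans q₀≡x x≡q₁)
  ... | no q₀≢x = proj₁ (meet x (quad zero) (q₀≢x ∘ sym)) , proj₁ (proj₂ (meet x (quad zero) (q₀≢x ∘ sym)))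
  off-line : ∀ j → ∃[ z ] lookup (line j) z ≡ false
  off-line j with lookup (line j) (quad zero) in e₀ | lookup (line j) (quad (suc zero)) in e₁
                | lookup (line j) (quad (suc (suc zero))) in e₂
  ... | false | _     | _     = quad zero , e₀
  ... | true  | false | _     = quad (suc zero) , e₁
  ... | true  | true  | false = quad (suc (suc zero)) , e₂
  ... | true  | true  | true  = ⊥-elim (quadGeneral zero (suc zero) (suc (suc zero)) (λ ()) (λ ()) (λ ()) j
                                  (∈ᵇ⇒∈ {p = line j} e₀ , ∈ᵇ⇒∈ {p = line j} e₁ , ∈ᵇ⇒∈ {p = line j} e₂))
  distinct : IsDistinct S
  distinct x y x≢y Sx≡Sy with twoPoints x y x≢y
  ... | j₀ , x∈j₀ , y∈j₀ with off-line j₀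
  ...   | z , z∉j₀ with x ≟ᶠ z
  ...     | yes refl = case trans (sym (∈⇒∈ᵇ x∈j₀)) z∉j₀ of λ ()
  ...     | no  x≢z with twoPoints x z x≢z
  ...       | j₁ , x∈j₁ , z∈j₁ = case trans (sym (∈⇒∈ᵇ (subst (λ j → z ∈ line j) (sym j₀≡j₁) z∈j₁))) z∉j₀ of λ ()
    where
    y∈j₁ : y ∈ line j₁
    y∈j₁ = on (subst (j₁ ∈ᵇ_) Sx≡Sy (through x∈j₁))
    j₀≡j₁ : j₀ ≡ j₁
    j₀≡j₁ = twoPointsUnique x y x≢y j₀ j₁ x∈j₀ y∈j₀ x∈j₁ y∈j₁

-- Near-pencil on n = 3 + m vertices, with the last vertex t (index L = n − 1):
-- symbol 0 is the long line of all vertices below t, symbol suc i the short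
-- line {i , t}.  Each vertex below t owns its short line; t and a vertex
-- i below it share exactly suc i; two vertices below t share exactly 0.
module NearPencil (m : ℕ) where
  n L : ℕ
  n = 3 + m
  L = 2 + m

  S : Family n n
  S = egp (nearPencil n)

  on-long : ∀ v → lookup (S v) zero ≡ ⌊ toℕ v <? L ⌋
  on-long v = trans (egp-lookup (nearPencil n) v zero) (lookup∘tabulate (λ w → ⌊ toℕ w <? L ⌋) v)

  on-short : ∀ i v → lookup (S v) (suc i) ≡ ⌊ (toℕ v ≟ toℕ i) ⊎-dec (toℕ v ≟ L) ⌋
  on-short i v = trans (egp-lookup (nearPencil n) v (suc i))
                   (lookup∘tabulate (λ w → ⌊ (toℕ w ≟ toℕ i) ⊎-dec (toℕ w ≟ L) ⌋) v)

  long⇒ : ∀ v → zero ∈ᵇ S v → toℕ v < L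
  long⇒ v e = accepted (toℕ v <? L) (trans (sym (on-long v)) e)

  ⇒long : ∀ v → toℕ v < L → zero ∈ᵇ S v
  ⇒long v v<L = trans (on-long v) (accept (toℕ v <? L) v<L)

  short⇒ : ∀ i v → suc i ∈ᵇ S v → toℕ v ≡ toℕ i ⊎ toℕ v ≡ L
  short⇒ i v e = accepted ((toℕ v ≟ toℕ i) ⊎-dec (toℕ v ≟ L)) (trans (sym (on-short i v)) e)

  ⇒short : ∀ i v → toℕ v ≡ toℕ i ⊎ toℕ v ≡ L → suc i ∈ᵇ S v
  ⇒short i v h = trans (on-short i v) (accept ((toℕ v ≟ toℕ i) ⊎-dec (toℕ v ≟ L)) h)

  data Position (v : Fin n) : Set where
    below : toℕ v < L → Position v
    top   : toℕ v ≡ L → Position v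

  position : ∀ v → Position v
  position v with m≤n⇒m<n∨m≡n (≤-pred (toℕ<n v))
  ... | inj₁ v<L = below v<L
  ... | inj₂ v≡L = top v≡L

  tops-equal : ∀ {x y : Fin n} → toℕ x ≡ L → toℕ y ≡ L → x ≡ y
  tops-equal x≡L y≡L = toℕ-injective (trans x≡L (sym y≡L))

  own : ∀ {v : Fin n} → toℕ v < L → Fin n
  own v<L = suc (fromℕ< v<L)

  in-own : ∀ v (v<L : toℕ v < L) → own v<L ∈ᵇ S v
  in-own v v<L = ⇒short (fromℕ< v<L) v (inj₁ (sym (toℕ-fromℕ< v<L)))

  top-in-short : ∀ i v → toℕ v ≡ L → suc i ∈ᵇ S v
  top-in-short i v v≡L = ⇒short i v (inj₂ v≡L)

  shared : ∀ {x y} → Position x → Position y → Fin n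
  shared (below _)   (below _)   = zero
  shared (top _)     (below y<L) = own y<L
  shared (below x<L) (top _)     = own x<L
  shared (top _)     (top _)     = zero

  own-injective : ∀ {x y : Fin n} (x<L : toℕ x < L) (y<L : toℕ y < L) → own x<L ≡ own y<L → x ≡ y
  own-injective x<L y<L e =
    toℕ-injective (trans (sym (toℕ-fromℕ< x<L)) (trans (cong toℕ (fsuc-injective e)) (toℕ-fromℕ< y<L)))

  short-below : ∀ i v (v<L : toℕ v < L) → suc i ∈ᵇ S v → suc i ≡ own v<L
  short-below i v v<L e with short⇒ i v e
  ... | inj₁ v≡i = cong suc (toℕ-injective (trans (sym v≡i) (sym (toℕ-fromℕ< v<L))))
  ... | inj₂ v≡L = ⊥-elim (<⇒≢ v<L v≡L)

  only-shared : ∀ x y → x ≢ y → (px : Position x) (py : Position y) → ∀ j →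
    j ∈ᵇ S x → j ∈ᵇ S y → j ≡ shared px py
  only-shared x y x≢y (top x≡L)   (top y≡L)   j       _   _   = ⊥-elim (x≢y (tops-equal x≡L y≡L))
  only-shared x y x≢y (below _)   (below _)   zero    _   _   = refl
  only-shared x y x≢y (below x<L) (below y<L) (suc i) j∈x j∈y =
    ⊥-elim (x≢y (own-injective x<L y<L (trans (sym (short-below i x x<L j∈x)) (short-below i y y<L j∈y))))
  only-shared x y x≢y (top x≡L)   (below _)   zero    j∈x _   = ⊥-elim (<⇒≢ (long⇒ x j∈x) x≡L)
  only-shared x y x≢y (top _)     (below y<L) (suc i) _   j∈y = short-below i y y<L j∈y
  only-shared x y x≢y (below _)   (top y≡L)   zero    _   j∈y = ⊥-elim (<⇒≢ (long⇒ y j∈y) y≡L)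
  only-shared x y x≢y (below x<L) (top _)     (suc i) j∈x _   = short-below i x x<L j∈x

  -- A vertex below t is the only one on its short line apart from t, and t
  -- is not on the long line; so every set differs from every other.
  distinct-below : ∀ x y → x ≢ y → (x<L : toℕ x < L) → S x ≢ S y
  distinct-below x y x≢y x<L Sx≡Sy with short⇒ (fromℕ< x<L) y (subst (own x<L ∈ᵇ_) Sx≡Sy (in-own x x<L))
  ... | inj₁ y≡x = x≢y (toℕ-injective (trans (sym (toℕ-fromℕ< x<L)) (sym y≡x)))
  ... | inj₂ y≡L = <⇒≢ (long⇒ y (subst (zero ∈ᵇ_) Sx≡Sy (⇒long x x<L))) y≡L

  near-pencil-sd : SDComplete S
  near-pencil-sd = record
    { nonempty = nonempty
    ; meet     = meet
    ; unique   = λ x y x≢y u v u∈x u∈y v∈x v∈y →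
        trans (only-shared x y x≢y (position x) (position y) u u∈x u∈y)
              (sym (only-shared x y x≢y (position x) (position y) v v∈x v∈y))
    ; distinct = distinct
    }
    where
    nonempty : ∀ x → ∃[ j ] j ∈ᵇ S x
    nonempty x with position x
    ... | below x<L = zero , ⇒long x x<L
    ... | top x≡L   = suc zero , top-in-short zero x x≡L
    meet : ∀ x y → x ≢ y → ∃[ j ] (j ∈ᵇ S x × j ∈ᵇ S y)
    meet x y x≢y with position x | position y
    ... | below x<L | below y<L = zero , ⇒long x x<L , ⇒long y y<L
    ... | top x≡L   | below y<L = own y<L , top-in-short (fromℕ< y<L) x x≡L , in-own y y<L
    ... | below x<L | top y≡L   = own x<L , in-own x x<L , top-in-short (fromℕ< x<L) y y≡L
    ... | top x≡L   | top y≡L   = ⊥-elim (x≢y (tops-equal x≡L y≡L))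
    distinct : IsDistinct S
    distinct x y x≢y with position x | position y
    ... | below x<L | _         = distinct-below x y x≢y x<L
    ... | top _     | below y<L = distinct-below y x (x≢y ∘ sym) y<L ∘ sym
    ... | top x≡L   | top y≡L   = ⊥-elim (x≢y (tops-equal x≡L y≡L))

mainTheorem9 : (n : ℕ) → 3 ≤ n →
    InFsd (Complete n) (egp (nearPencil n)) ×
    ((P : ProjectivePlane n) → ∃[ r ] (n ≡ r * r + r + 1) →
      InFsd (Complete n) (egp (ProjectivePlane.line P))) ×
    InFsd (Complete n) (egp (sillyPartition n))
mainTheorem9 n@(suc (suc (suc m))) 3≤n =
  optimal n 3≤n _ (NearPencil.near-pencil-sd m) ,
  (λ P _ → optimal n 3≤n _ (plane-sd P)) ,
  optimal n 3≤n _ (silly-sd (suc (suc m)))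
mainTheorem9 (suc zero)       (s≤s ())
mainTheorem9 (suc (suc zero)) (s≤s (s≤s ()))
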